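{- Let $G$ be a graph and $v \in V(G)$. If there exists a proper edge-coloring of $G$ containing no rainbow copy of $C_4$, then the subgraph $G[N(v)]$ of $G$ induced on the neighborhood $N(v)$ does not contain (as a not necessarily induced subgraph) any of the following: (1) a triangle $K_3$ together with two pendant edges attached at two distinct vertices of the triangle (with two distinct new endpoints outside the triangle); (2) a cycle $C_4$; (3) a cycle $C_k$ together with one pendant edge, for any $k \geq 5$; (4) the double star $D_{2,2}$, or any subdivision of it.
   Context: An edge-coloring of a graph $G$ is a function $c: E(G)\to\mathbb{N}$; it is proper if any two edges sharing a vertex receive distinct colors. A subgraph is rainbow if all its edges receive distinct colors. $N(v)$ is the set of neighbors of $v$, and $G[S]$ the subgraph induced on $S$. The double star $D_{2,2}$ is the tree on $6$ vertices consisting of an edge $ab$ together with two further leaves adjacent to $a$ and two further leaves adjacent to $b$. A subdivision of a graph is obtained by replacing edges with internally vertex-disjoint paths. -}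

module Defs where

open import Data.Nat using (ℕ; zero; suc; _≤_)
open import Data.Fin using (Fin; toℕ; fromℕ)
open import Data.Fin.Patterns using (0F; 1F; 2F; 3F)
open import Data.Sum using (_⊎_; inj₁; inj₂)
open import Data.Product using (Σ; _×_; _,_; ∃-syntax)
open import Data.Unit using (⊤; tt)
open import Data.Empty using (⊥)
open import Relation.Nullary using (¬_)
open import Relation.Binary.PropositionalEquality using (_≡_; _≢_)
open import Function.Definitions using (Injective)

record Graph (n : ℕ) : Set₁ where
  field
    Adj     : Fin n → Fin n → Set
    sym     : ∀ {u v} → Adj u v → Adj v u
    irrefl  : ∀ {u} → ¬ Adj u u
open Graph public

record EdgeColoring {n : ℕ} (G : Graph n) : Set where
  field
    col     : Fin n → Fin n → ℕ
    col-sym : ∀ {u v} → Adj G u v → col u v ≡ col v u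
open EdgeColoring public

Proper : {n : ℕ} {G : Graph n} → EdgeColoring G → Set
Proper {n} {G} c =
  ∀ {u v w} → Adj G u v → Adj G u w → v ≢ w → col c u v ≢ col c u w

RainbowC4 : {n : ℕ} {G : Graph n} → EdgeColoring G → Set
RainbowC4 {n} {G} c =
  ∃[ a ] ∃[ b ] ∃[ d ] ∃[ e ]
    ( a ≢ d × b ≢ e
    × Adj G a b × Adj G b d × Adj G d e × Adj G e a
    × col c a b ≢ col c b d × col c a b ≢ col c d e × col c a b ≢ col c e a
    × col c b d ≢ col c d e × col c b d ≢ col c e a
    × col c d e ≢ col c e a )

-- Pattern graphs: a vertex type with an edge relation (E x y means
-- {x,y} is an edge; the relation need not be listed symmetrically).

record Pattern : Set₁ where
  field
    V : Set
    E : V → V → Set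
open Pattern public

ContainsInNbhd : {n : ℕ} → Graph n → Fin n → Pattern → Set
ContainsInNbhd {n} G v H =
  Σ (V H → Fin n) λ f →
      Injective _≡_ _≡_ f
    × (∀ x → Adj G v (f x))
    × (∀ x y → E H x y → Adj G (f x) (f y))

TrianglePendE : Fin 3 ⊎ Fin 2 → Fin 3 ⊎ Fin 2 → Set
TrianglePendE (inj₁ 0F) (inj₁ 1F) = ⊤
TrianglePendE (inj₁ 1F) (inj₁ 2F) = ⊤
TrianglePendE (inj₁ 2F) (inj₁ 0F) = ⊤
TrianglePendE (inj₂ 0F) (inj₁ 0F) = ⊤
TrianglePendE (inj₂ 1F) (inj₁ 1F) = ⊤
TrianglePendE _ _ = ⊥

TrianglePendants : Pattern
TrianglePendants = record { V = Fin 3 ⊎ Fin 2 ; E = TrianglePendE }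

CycleE : (k : ℕ) → Fin k → Fin k → Set
CycleE k i j = (toℕ j ≡ suc (toℕ i)) ⊎ (suc (toℕ i) ≡ k × toℕ j ≡ 0)

Cycle : ℕ → Pattern
Cycle k = record { V = Fin k ; E = CycleE k }

CyclePendE : (k : ℕ) → Fin k ⊎ ⊤ → Fin k ⊎ ⊤ → Set
CyclePendE k (inj₁ i) (inj₁ j) = CycleE k i j
CyclePendE k (inj₂ _) (inj₁ j) = toℕ j ≡ 0
CyclePendE k _ _ = ⊥

CyclePendant : ℕ → Pattern
CyclePendant k = record { V = Fin k ⊎ ⊤ ; E = CyclePendE k }

-- The central edge ab becomes a path spine 0 — 1 — … — (s+1), with
-- a = spine 0 and b = spine (s+1).  Each of the four leaf edges
-- (legs 0,1 at a; legs 2,3 at b) becomes a path with ℓ i + 1 ≥ 1 edges: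
-- leg i consists of vertices (i , 0), …, (i , ℓ i), where (i , 0) is
-- attached to its centre and consecutive vertices are adjacent.
-- s = 0 and ℓ = const 0 gives D_{2,2} itself.
SubD22V : ℕ → (Fin 4 → ℕ) → Set
SubD22V s ℓ = Fin (suc (suc s)) ⊎ Σ (Fin 4) (λ i → Fin (suc (ℓ i)))

SubD22E : (s : ℕ) (ℓ : Fin 4 → ℕ) → SubD22V s ℓ → SubD22V s ℓ → Set
SubD22E s ℓ (inj₁ j) (inj₁ j') = toℕ j' ≡ suc (toℕ j)
SubD22E s ℓ (inj₂ (i , k)) (inj₂ (i' , k')) = i ≡ i' × toℕ k' ≡ suc (toℕ k)
SubD22E s ℓ (inj₂ (0F , k)) (inj₁ j) = toℕ k ≡ 0 × toℕ j ≡ 0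
SubD22E s ℓ (inj₂ (1F , k)) (inj₁ j) = toℕ k ≡ 0 × toℕ j ≡ 0
SubD22E s ℓ (inj₂ (2F , k)) (inj₁ j) = toℕ k ≡ 0 × toℕ j ≡ suc s
SubD22E s ℓ (inj₂ (3F , k)) (inj₁ j) = toℕ k ≡ 0 × toℕ j ≡ suc s
SubD22E s ℓ (inj₁ _) (inj₂ _) = ⊥

SubdividedD22 : ℕ → (Fin 4 → ℕ) → Pattern
SubdividedD22 s ℓ = record { V = SubD22V s ℓ ; E = SubD22E s ℓ }

-- Fix the colouring and call vx (x ∈ N(v)) a spoke. For a path x–y–z in
-- G[N(v)] the 4-cycle v x y z is not rainbow, and properness already separates
-- its adjacent edges, so yz has the colour of the spoke vx or xy that of vz; in
-- the first case say that x labels yz. Properness at v makes labels unique, and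
-- properness elsewhere forbids one label on two edges at a vertex. Consequently
-- labels march along paths: if x labels yz and z–w is the next edge, then y
-- labels zw. On a square the march gives opposite edges distinct labels, hence
-- a rainbow C₄. Around a longer cycle it determines the label of the edge into
-- the start vertex, which is incompatible with both possible labels forced by a
-- pendant edge. On a subdivided double star the leaves at either end label the
-- end edges, while the march from one end forces a label from the path on the
-- other end edge.
module Submission where

open import Defs
open import Data.Nat using (ℕ; zero; suc; _+_; _≤_; _<_; z≤n; s≤s; NonZero)
open import Data.Nat.Properties
  using (_≟_; ≤-refl; ≤-trans; n≤1+n; <⇒≤; m≤n+m; m≢1+n+m)
open import Data.Nat.DivMod using (_mod_; m<n⇒m%n≡m)
open import Data.Fin using (Fin; toℕ; zero)
open import Data.Fin.Patterns using (0F; 1F; 2F; 3F)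
open import Data.Fin.Properties using (toℕ-fromℕ<)
open import Data.Product using (Σ; _×_; _,_)
open import Data.Sum using (_⊎_; inj₁; inj₂; [_,_]′)
open import Data.Sum.Properties using (inj₁-injective)
open import Data.Unit using (tt)
open import Data.Empty using (⊥; ⊥-elim)
open import Relation.Nullary using (¬_; yes; no; contraposition)
open import Relation.Binary.PropositionalEquality as ≡
  using (_≡_; _≢_; refl; cong; ≢-sym)

toℕ-mod : ∀ {i m} .{{_ : NonZero m}} → i < m → toℕ (i mod m) ≡ i
toℕ-mod i<m = ≡.trans (toℕ-fromℕ< _) (m<n⇒m%n≡m i<m)

module Paths {n : ℕ} (G : Graph n) (v : Fin n) where

  -- Only the first L + 1 vertices form the path; the others are unconstrained.
  record NbhdPath (L : ℕ) : Set where
    field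
      vertex   : ℕ → Fin n
      in-nbhd  : ∀ i → Adj G v (vertex i)
      edge     : ∀ i → i < L → Adj G (vertex i) (vertex (suc i))
      distinct : ∀ {i j} → i ≤ L → j ≤ L → i ≢ j → vertex i ≢ vertex j

  fin-path : ∀ {L} (g : Fin (suc L) → Fin n) → (∀ {i j} → g i ≡ g j → i ≡ j) →
    (∀ i → Adj G v (g i)) → (∀ i j → toℕ j ≡ suc (toℕ i) → Adj G (g i) (g j)) →
    NbhdPath L
  fin-path {L} g g-inj g-nbhd g-edge = record
    { vertex   = λ i → g (i mod suc L)
    ; in-nbhd  = λ i → g-nbhd (i mod suc L)
    ; edge     = λ i i<L → g-edge _ _
        (≡.trans (toℕ-mod (s≤s i<L)) (cong suc (≡.sym (toℕ-mod (s≤s (<⇒≤ i<L))))))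
    ; distinct = λ i≤L j≤L i≢j gi≡gj → i≢j
        (≡.trans (≡.sym (toℕ-mod (s≤s i≤L)))
                 (≡.trans (cong toℕ (g-inj gi≡gj)) (toℕ-mod (s≤s j≤L))))
    }

module Labelling {n : ℕ} {G : Graph n} {v : Fin n} (c : EdgeColoring G)
                 (proper : Proper c) (no-rainbow : ¬ RainbowC4 c) where

  open Paths G v

  adjacent-distinct : ∀ {a b} → Adj G a b → a ≢ b
  adjacent-distinct ab refl = irrefl G ab

  consecutive-colours-distinct : ∀ {a b d} → Adj G a b → Adj G b d → a ≢ d →
    col c a b ≢ col c b d
  consecutive-colours-distinct ab bd a≢d ab≡bd =
    proper (sym G ab) bd a≢d (≡.trans (≡.sym (col-sym c ab)) ab≡bd)

  opposite-edges-share-colour : ∀ {a b d e} → a ≢ d → b ≢ e →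
    Adj G a b → Adj G b d → Adj G d e → Adj G e a →
    col c a b ≡ col c d e ⊎ col c b d ≡ col c e a
  opposite-edges-share-colour {a} {b} {d} {e} a≢d b≢e ab bd de ea
    with col c a b ≟ col c d e | col c b d ≟ col c e a
  ... | yes ab≡de | _        = inj₁ ab≡de
  ... | no _      | yes bd≡ea = inj₂ bd≡ea
  ... | no ab≢de  | no bd≢ea  = ⊥-elim (no-rainbow
        (a , b , d , e , a≢d , b≢e , ab , bd , de , ea ,
          consecutive-colours-distinct ab bd a≢d , ab≢de ,
          ≢-sym (consecutive-colours-distinct ea ab (≢-sym b≢e)) ,
          consecutive-colours-distinct bd de b≢e , bd≢ea ,
          consecutive-colours-distinct de ea (≢-sym a≢d)))

  spoke : Fin n → ℕ
  spoke = col c v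

  Labels : Fin n → Fin n → Fin n → Set
  Labels x y z = col c y z ≡ spoke x

  labels-flip : ∀ {x y z} → Adj G y z → Labels x y z → Labels x z y
  labels-flip yz = ≡.trans (≡.sym (col-sym c yz))

  labels-distinct : ∀ {x x′ a b d e} → Adj G v x → Adj G v x′ → x ≢ x′ →
    Labels x a b → Labels x′ d e → col c a b ≢ col c d e
  labels-distinct vx vx′ x≢x′ l l′ ab≡de =
    proper vx vx′ x≢x′ (≡.trans (≡.sym l) (≡.trans ab≡de l′))

  labels-unique : ∀ {x x′ y z} → Adj G v x → Adj G v x′ → x ≢ x′ →
    Labels x y z → Labels x′ y z → ⊥
  labels-unique vx vx′ x≢x′ l l′ = labels-distinct vx vx′ x≢x′ l l′ refl

  labels-proper : ∀ {x y a b} → Adj G y a → Adj G y b → a ≢ b →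
    Labels x y a → Labels x y b → ⊥
  labels-proper ya yb a≢b l l′ = proper ya yb a≢b (≡.trans l (≡.sym l′))

  labels-path : ∀ {x y z} → Adj G v x → Adj G v y → Adj G v z →
    Adj G x y → Adj G y z → x ≢ z → Labels x y z ⊎ Labels z x y
  labels-path vx vy vz xy yz x≢z
    with opposite-edges-share-colour (adjacent-distinct vy) x≢z vx xy yz (sym G vz)
  ... | inj₁ vx≡yz = inj₁ (≡.sym vx≡yz)
  ... | inj₂ xy≡zv = inj₂ (≡.trans xy≡zv (≡.sym (col-sym c vz)))

  labels-propagate : ∀ {x y z w} → Adj G v x → Adj G v y → Adj G v z → Adj G v w →
    Adj G y z → Adj G z w → y ≢ w → x ≢ w → Labels x y z → Labels y z w
  labels-propagate vx vy vz vw yz zw y≢w x≢w l with labels-path vy vz vw yz zw y≢w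
  ... | inj₁ l′ = l′
  ... | inj₂ l′ = ⊥-elim (labels-unique vx vw x≢w l l′)

  labels-fork : ∀ {x₁ x₂ y z} → Adj G v x₁ → Adj G v x₂ → Adj G v y → Adj G v z →
    Adj G x₁ y → Adj G x₂ y → Adj G y z → x₁ ≢ z → x₂ ≢ z → x₁ ≢ x₂ →
    Labels x₁ y z ⊎ Labels x₂ y z
  labels-fork v₁ v₂ vy vz x₁y x₂y yz x₁≢z x₂≢z x₁≢x₂
    with labels-path v₁ vy vz x₁y yz x₁≢z | labels-path v₂ vy vz x₂y yz x₂≢z
  ... | inj₁ l  | _      = inj₁ l
  ... | inj₂ _  | inj₁ l = inj₂ l
  ... | inj₂ l₁ | inj₂ l₂ = ⊥-elim
    (labels-proper (sym G x₁y) (sym G x₂y) x₁≢x₂ (labels-flip x₁y l₁) (labels-flip x₂y l₂))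

  labels-pendant : ∀ {p y a b} → Adj G v p → Adj G v y → Adj G v a → Adj G v b →
    Adj G p y → Adj G y a → Adj G y b → p ≢ a → p ≢ b → a ≢ b →
    Labels p y a ⊎ Labels p y b
  labels-pendant vp vy va vb py ya yb p≢a p≢b a≢b
    with labels-path vp vy va py ya p≢a | labels-path vp vy vb py yb p≢b
  ... | inj₁ l  | _      = inj₁ l
  ... | inj₂ _  | inj₁ l = inj₂ l
  ... | inj₂ l₁ | inj₂ l₂ = ⊥-elim (labels-unique va vb a≢b l₁ l₂)

  module _ {L : ℕ} (P : NbhdPath L) where
    open NbhdPath P

    OffPath : Fin n → Set
    OffPath x = ∀ i → i ≤ L → x ≢ vertex i

    labels-along : ∀ {x} → Adj G v x → x ≢ vertex 2 → Labels x (vertex 0) (vertex 1) →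
      ∀ i → 2 + i ≤ L → Labels (vertex i) (vertex (1 + i)) (vertex (2 + i))
    labels-along vx x≢2 l zero 2≤L =
      labels-propagate vx (in-nbhd 0) (in-nbhd 1) (in-nbhd 2) (edge 0 (<⇒≤ 2≤L)) (edge 1 2≤L)
        (distinct z≤n 2≤L (λ ())) x≢2 l
    labels-along vx x≢2 l (suc i) 3+i≤L =
      labels-propagate (in-nbhd i) (in-nbhd (1 + i)) (in-nbhd (2 + i)) (in-nbhd (3 + i))
        (edge (1 + i) (<⇒≤ 3+i≤L)) (edge (2 + i) 3+i≤L)
        (distinct (≤-trans (m≤n+m (1 + i) 2) 3+i≤L) 3+i≤L (m≢1+n+m (1 + i) {1}))
        (distinct (≤-trans (m≤n+m i 3) 3+i≤L) 3+i≤L (m≢1+n+m i {2}))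
        (labels-along vx x≢2 l i (<⇒≤ 3+i≤L))

  no-foreign-labels-at-both-ends : ∀ {M x y} (P : NbhdPath (suc M)) → let open NbhdPath P in
    Adj G v x → OffPath P x → Labels x (vertex 0) (vertex 1) →
    Adj G v y → OffPath P y → x ≢ y → ¬ Labels y (vertex M) (vertex (suc M))
  no-foreign-labels-at-both-ends {zero} P vx x-off l vy y-off x≢y = labels-unique vx vy x≢y l
  no-foreign-labels-at-both-ends {suc M} P vx x-off l vy y-off x≢y =
    labels-unique (in-nbhd M) vy (≢-sym (y-off M (≤-trans (n≤1+n M) (n≤1+n (suc M)))))
      (labels-along P vx (x-off 2 (s≤s (s≤s z≤n))) l M ≤-refl)
    where open NbhdPath P

  module _ {K : ℕ} (P : NbhdPath (3 + K)) where
    open NbhdPath P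

    labels-close-cycle : ∀ {x} → Adj G (vertex (3 + K)) (vertex 0) →
      Adj G v x → x ≢ vertex 2 → Labels x (vertex 0) (vertex 1) →
      Labels (vertex (2 + K)) (vertex (3 + K)) (vertex 0)
    labels-close-cycle close vx x≢2 l =
      labels-propagate (in-nbhd (1 + K)) (in-nbhd (2 + K)) (in-nbhd (3 + K)) (in-nbhd 0)
        (edge (2 + K) ≤-refl) close
        (distinct (n≤1+n (2 + K)) z≤n (λ ()))
        (distinct (≤-trans (n≤1+n (1 + K)) (n≤1+n (2 + K))) z≤n (λ ()))
        (labels-along P vx x≢2 l (1 + K) ≤-refl)

  square-unlabelled : ∀ {a b d e} → Adj G v a → Adj G v b → Adj G v d → Adj G v e →
    a ≢ d → b ≢ e → Adj G a b → Adj G b d → Adj G d e → Adj G e a → ¬ Labels a b d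
  square-unlabelled {a} {b} {d} {e} va vb vd ve a≢d b≢e ab bd de ea l₁ =
    [ labels-distinct ve vb (≢-sym b≢e) l₄ l₂ , labels-distinct va vd a≢d l₁ l₃ ]′
      (opposite-edges-share-colour a≢d b≢e ab bd de ea)
    where
    l₂ : Labels b d e
    l₂ = labels-propagate va vb vd ve bd de b≢e (adjacent-distinct (sym G ea)) l₁
    l₃ : Labels d e a
    l₃ = labels-propagate vb vd ve va de ea (≢-sym a≢d) (adjacent-distinct (sym G ab)) l₂
    l₄ : Labels e a b
    l₄ = labels-propagate vd ve va vb ea ab (≢-sym b≢e) (adjacent-distinct (sym G bd)) l₃

  no-triangle-with-pendants : ¬ ContainsInNbhd G v TrianglePendants
  no-triangle-with-pendants (f , f-inj , f-nbhd , f-edge) = contradiction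
    where
    apart : ∀ {a b} → a ≢ b → f a ≢ f b
    apart = contraposition f-inj
    x y z p q : Fin n
    x = f (inj₁ 0F)
    y = f (inj₁ 1F)
    z = f (inj₁ 2F)
    p = f (inj₂ 0F)
    q = f (inj₂ 1F)
    vx : Adj G v x
    vx = f-nbhd (inj₁ 0F)
    vy : Adj G v y
    vy = f-nbhd (inj₁ 1F)
    vz : Adj G v z
    vz = f-nbhd (inj₁ 2F)
    vp : Adj G v p
    vp = f-nbhd (inj₂ 0F)
    vq : Adj G v q
    vq = f-nbhd (inj₂ 1F)
    xy : Adj G x y
    xy = f-edge (inj₁ 0F) (inj₁ 1F) tt
    yz : Adj G y z
    yz = f-edge (inj₁ 1F) (inj₁ 2F) tt
    zx : Adj G z x
    zx = f-edge (inj₁ 2F) (inj₁ 0F) tt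
    px : Adj G p x
    px = f-edge (inj₂ 0F) (inj₁ 0F) tt
    qy : Adj G q y
    qy = f-edge (inj₂ 1F) (inj₁ 1F) tt

    xy-z : Labels z x y
    xy-z with labels-fork vp vz vx vy px zx xy (apart λ ()) (apart λ ()) (apart λ ())
            | labels-fork vq vz vy vx qy (sym G yz) (sym G xy)
                (apart λ ()) (apart λ ()) (apart λ ())
    ... | inj₂ l  | _       = l
    ... | inj₁ lp | inj₁ lq =
      ⊥-elim (labels-unique vp vq (apart λ ()) lp (labels-flip (sym G xy) lq))
    ... | inj₁ lp | inj₂ lz =
      ⊥-elim (labels-unique vp vz (apart λ ()) lp (labels-flip (sym G xy) lz))

    xz-p : Labels p x z
    xz-p with labels-path vp vx vz px (sym G zx) (apart λ ())
    ... | inj₁ l = l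
    ... | inj₂ l = ⊥-elim (labels-proper (sym G px) xy (apart λ ()) (labels-flip px l) xy-z)

    yz-q : Labels q y z
    yz-q with labels-path vq vy vz qy yz (apart λ ())
    ... | inj₁ l = l
    ... | inj₂ l = ⊥-elim
      (labels-proper (sym G qy) (sym G xy) (apart λ ()) (labels-flip qy l) (labels-flip xy xy-z))

    contradiction : ⊥
    contradiction with labels-path vx vz vy (sym G zx) (sym G yz) (apart λ ())
    ... | inj₁ l = labels-unique vx vq (apart λ ()) l (labels-flip yz yz-q)
    ... | inj₂ l = labels-unique vy vp (apart λ ()) l xz-p

  no-square : ¬ ContainsInNbhd G v (Cycle 4)
  no-square (f , f-inj , f-nbhd , f-edge) = contradiction
    where
    apart : ∀ {a b} → a ≢ b → f a ≢ f b
    apart = contraposition f-inj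
    wx : Adj G (f 0F) (f 1F)
    wx = f-edge 0F 1F (inj₁ refl)
    xy : Adj G (f 1F) (f 2F)
    xy = f-edge 1F 2F (inj₁ refl)
    yz : Adj G (f 2F) (f 3F)
    yz = f-edge 2F 3F (inj₁ refl)
    zw : Adj G (f 3F) (f 0F)
    zw = f-edge 3F 0F (inj₂ (refl , refl))

    contradiction : ⊥
    contradiction with labels-path (f-nbhd 0F) (f-nbhd 1F) (f-nbhd 2F) wx xy (apart λ ())
    ... | inj₁ l = square-unlabelled (f-nbhd 0F) (f-nbhd 1F) (f-nbhd 2F) (f-nbhd 3F)
                     (apart λ ()) (apart λ ()) wx xy yz zw l
    ... | inj₂ l = square-unlabelled (f-nbhd 2F) (f-nbhd 1F) (f-nbhd 0F) (f-nbhd 3F)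
                     (apart λ ()) (apart λ ()) (sym G xy) (sym G wx) (sym G zw) (sym G yz)
                     (labels-flip wx l)

  no-cycle-with-pendant : ∀ k → 4 ≤ k → ¬ ContainsInNbhd G v (CyclePendant k)
  no-cycle-with-pendant _ (s≤s (s≤s (s≤s (s≤s (z≤n {K}))))) (f , f-inj , f-nbhd , f-edge) =
    contradiction
    where
    P : NbhdPath (3 + K)
    P = fin-path (λ i → f (inj₁ i)) (λ e → inj₁-injective (f-inj e)) (λ i → f-nbhd (inj₁ i))
          (λ i j e → f-edge (inj₁ i) (inj₁ j) (inj₁ e))
    open NbhdPath P
    close : Adj G (vertex (3 + K)) (vertex 0)
    close = f-edge (inj₁ _) (inj₁ _) (inj₂ (cong suc (toℕ-mod ≤-refl) , refl))
    p : Fin n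
    p = f (inj₂ tt)
    vp : Adj G v p
    vp = f-nbhd (inj₂ tt)
    p-off : ∀ i → p ≢ vertex i
    p-off i = contraposition f-inj λ ()
    p-u₀ : Adj G p (vertex 0)
    p-u₀ = f-edge (inj₂ tt) (inj₁ _) refl
    u₀u₁ : Adj G (vertex 0) (vertex 1)
    u₀u₁ = edge 0 (s≤s z≤n)
    u₁≢u₂₊ : vertex 1 ≢ vertex (2 + K)
    u₁≢u₂₊ = distinct (s≤s z≤n) (n≤1+n _) λ ()

    contradiction : ⊥
    contradiction
      with labels-pendant vp (in-nbhd 0) (in-nbhd 1) (in-nbhd (3 + K))
             p-u₀ u₀u₁ (sym G close) (p-off 1) (p-off (3 + K))
             (distinct (s≤s z≤n) ≤-refl λ ())
         | labels-path (in-nbhd (3 + K)) (in-nbhd 0) (in-nbhd 1) close u₀u₁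
             (distinct ≤-refl (s≤s z≤n) λ ())
    ... | inj₁ p-u₀u₁ | inj₁ last-u₀u₁ =
      labels-unique vp (in-nbhd (3 + K)) (p-off (3 + K)) p-u₀u₁ last-u₀u₁
    ... | inj₂ p-u₀last | inj₁ last-u₀u₁ =
      labels-unique vp (in-nbhd (2 + K)) (p-off (2 + K)) (labels-flip (sym G close) p-u₀last)
        (labels-close-cycle P close (in-nbhd (3 + K))
           (distinct ≤-refl (s≤s (s≤s z≤n)) λ ()) last-u₀u₁)
    ... | inj₁ p-u₀u₁ | inj₂ u₁-lastu₀ =
      labels-unique (in-nbhd 1) (in-nbhd (2 + K)) u₁≢u₂₊ u₁-lastu₀
        (labels-close-cycle P close vp (p-off 2) p-u₀u₁)
    ... | inj₂ p-u₀last | inj₂ u₁-lastu₀ =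
      labels-unique vp (in-nbhd 1) (p-off 1) (labels-flip (sym G close) p-u₀last) u₁-lastu₀

  no-subdivided-double-star : ∀ s ℓ → ¬ ContainsInNbhd G v (SubdividedD22 s ℓ)
  no-subdivided-double-star s ℓ (f , f-inj , f-nbhd , f-edge) = contradiction
    where
    apart : ∀ {a b} → a ≢ b → f a ≢ f b
    apart = contraposition f-inj
    P : NbhdPath (suc s)
    P = fin-path (λ j → f (inj₁ j)) (λ e → inj₁-injective (f-inj e)) (λ j → f-nbhd (inj₁ j))
          (λ i j e → f-edge (inj₁ i) (inj₁ j) e)
    open NbhdPath P
    leaf : Fin 4 → Fin n
    leaf i = f (inj₂ (i , zero))
    leaf-nbhd : ∀ i → Adj G v (leaf i)
    leaf-nbhd i = f-nbhd (inj₂ (i , zero))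
    leaf-off : ∀ i → OffPath P (leaf i)
    leaf-off i j _ = apart λ ()
    first-edge : Adj G (vertex 0) (vertex 1)
    first-edge = edge 0 (s≤s z≤n)
    last-edge : Adj G (vertex (suc s)) (vertex s)
    last-edge = sym G (edge s ≤-refl)

    clash : ∀ {i j} → leaf i ≢ leaf j → Labels (leaf i) (vertex 0) (vertex 1) →
      Labels (leaf j) (vertex (suc s)) (vertex s) → ⊥
    clash i≢j first last = no-foreign-labels-at-both-ends P (leaf-nbhd _) (leaf-off _) first
      (leaf-nbhd _) (leaf-off _) i≢j (labels-flip last-edge last)

    contradiction : ⊥
    contradiction
      with labels-fork (leaf-nbhd 0F) (leaf-nbhd 1F) (in-nbhd 0) (in-nbhd 1)
             (f-edge (inj₂ (0F , _)) (inj₁ _) (refl , refl))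
             (f-edge (inj₂ (1F , _)) (inj₁ _) (refl , refl))
             first-edge (leaf-off 0F 1 (s≤s z≤n)) (leaf-off 1F 1 (s≤s z≤n)) (apart λ ())
         | labels-fork (leaf-nbhd 2F) (leaf-nbhd 3F) (in-nbhd (suc s)) (in-nbhd s)
             (f-edge (inj₂ (2F , _)) (inj₁ _) (refl , toℕ-mod ≤-refl))
             (f-edge (inj₂ (3F , _)) (inj₁ _) (refl , toℕ-mod ≤-refl))
             last-edge (leaf-off 2F s (n≤1+n s)) (leaf-off 3F s (n≤1+n s)) (apart λ ())
    ... | inj₁ first | inj₁ last = clash (apart λ ()) first last
    ... | inj₁ first | inj₂ last = clash (apart λ ()) first last
    ... | inj₂ first | inj₁ last = clash (apart λ ()) first last
    ... | inj₂ first | inj₂ last = clash (apart λ ()) first last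

lemma11 : (n : ℕ) (G : Graph n) (v : Fin n) →
    (Σ (EdgeColoring G) λ c → Proper c × ¬ RainbowC4 c) →
      ¬ ContainsInNbhd G v TrianglePendants
    × ¬ ContainsInNbhd G v (Cycle 4)
    × (∀ k → 5 ≤ k → ¬ ContainsInNbhd G v (CyclePendant k))
    × (∀ s ℓ → ¬ ContainsInNbhd G v (SubdividedD22 s ℓ))
lemma11 n G v (c , proper , no-rainbow) =
    no-triangle-with-pendants
  , no-square
  , (λ k 5≤k → no-cycle-with-pendant k (<⇒≤ 5≤k))
  , no-subdivided-double-star
  where open Labelling c proper no-rainbow
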